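{- For every $d\ge 2$ there is no strategy-proof algorithm (mechanism) that finds a stable matching in the $d$-list model.
   Context: A matching market consists of $n$ men and $n$ women. In the $d$-list model there are $d$ fixed rankings $\pi_1,\dots,\pi_d$ of the women and $d$ fixed rankings $\sigma_1,\dots,\sigma_d$ of the men; each man chooses one of the $\pi_i$ as his preference list and each woman chooses one of the $\sigma_j$ as hers. A matching $\mu$ is stable if there is no pair $(m,w)\notin\mu$ with $m$ preferring $w$ to $\mu(m)$ and $w$ preferring $m$ to $\mu(w)$. A mechanism takes the reported list choices of all participants and outputs a matching stable with respect to the reported preferences. It is strategy-proof if no participant can ever obtain a partner he or she strictly prefers (according to his or her true list) by reporting a different list choice while all others report truthfully; the lists themselves are fixed and only the choice of list can be misreported. -}

module Defs where

open import Data.Nat using (ℕ)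
open import Data.Fin using (Fin; _<_; _≟_)
open import Data.Fin.Permutation using (Permutation′; _⟨$⟩ʳ_; _⟨$⟩ˡ_)
open import Data.Product using (_×_; Σ)
open import Relation.Nullary using (¬_; yes; no)

-- A ranking of a set of n agents (identified with Fin n).
-- rank r x = position of x in the ranking (0 = most preferred).
Ranking : ℕ → Set
Ranking n = Permutation′ n

rank : ∀ {n} → Ranking n → Fin n → Fin n
rank r x = r ⟨$⟩ʳ x

Prefers : ∀ {n} → Ranking n → Fin n → Fin n → Set
Prefers r x y = rank r x < rank r y

-- A (perfect) matching of n men with n women: man m is matched to woman μ ⟨$⟩ʳ m,
-- woman w to man μ ⟨$⟩ˡ w.
Matching : ℕ → Set
Matching n = Permutation′ n

Choice : ℕ → ℕ → Set
Choice d n = Fin n → Fin d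

-- d-list model instance data: d rankings of the women (men's lists) and
-- d rankings of the men (women's lists).
-- Stability w.r.t. the lists πs, σs and reported choices cm (men), cw (women).
Stable : ∀ {d n} → (πs σs : Fin d → Ranking n) → Choice d n → Choice d n → Matching n → Set
Stable πs σs cm cw μ =
  ∀ m w → ¬ (Prefers (πs (cm m)) w (μ ⟨$⟩ʳ m) × Prefers (σs (cw w)) m (μ ⟨$⟩ˡ w))

Mechanism : ℕ → Set
Mechanism d = (n : ℕ) → (πs σs : Fin d → Ranking n) → Choice d n → Choice d n → Matching n

FindsStable : ∀ {d} → Mechanism d → Set
FindsStable {d} M = ∀ n (πs σs : Fin d → Ranking n) (cm cw : Choice d n) →
  Stable πs σs cm cw (M n πs σs cm cw)

_[_≔_] : ∀ {d n} → Choice d n → Fin n → Fin d → Choice d n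
(c [ a ≔ i ]) x with x ≟ a
... | yes _ = i
... | no  _ = c x

StrategyProof : ∀ {d} → Mechanism d → Set
StrategyProof {d} M = ∀ n (πs σs : Fin d → Ranking n) (cm cw : Choice d n) →
  (∀ m i → ¬ Prefers (πs (cm m)) (M n πs σs (cm [ m ≔ i ]) cw ⟨$⟩ʳ m)
                                 (M n πs σs cm cw ⟨$⟩ʳ m))
  × (∀ w j → ¬ Prefers (σs (cw w)) (M n πs σs cm (cw [ w ≔ j ]) ⟨$⟩ˡ w)
                                   (M n πs σs cm cw ⟨$⟩ˡ w))

-- Take two lists per side (further lists are never chosen) and a 5 × 5 market with a
-- truthful profile at which woman w₄ and man m₃ can each, by switching to their other
-- list, make every stable matching give them their true top choice (m₀, resp. w₁).
-- A strategy-proof mechanism must then give both of them their top choice already at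
-- the truthful profile, but no stable matching there pairs m₀–w₄ and m₃–w₁ at once.
-- The three facts about stable matchings are decided by enumerating all 5⁵ assignments.
module Submission where

open import Defs
open import Data.Nat using (ℕ; _≤_; zero; suc; z≤n; s≤s)
open import Data.Fin using (Fin; zero; suc; _<_; _≟_; #_)
open import Data.Fin.Properties using (all?; _<?_)
open import Data.Fin.Permutation using (_⟨$⟩ʳ_; _⟨$⟩ˡ_; permutation)
import Data.Fin.Permutation as Perm
open import Data.Vec.Functional using (Vector; []; _∷_; head; tail)
open import Data.Product using (_×_; Σ; _,_; proj₁; proj₂)
open import Data.Empty using (⊥-elim)
open import Function.Bundles using (Inverse; Injection)
open import Function.Properties.Inverse using (Inverse⇒Injection)
open import Relation.Binary.Definitions using (_Respects_)
open import Relation.Binary.PropositionalEquality using (_≡_; _≗_; refl; sym; trans; subst; subst₂)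
open import Relation.Nullary using (¬_; Dec; ¬?)
open import Relation.Nullary.Decidable using (_×-dec_; _→-dec_; map′; toWitness; True)
open import Relation.Unary using (Decidable)

ranking : ∀ {n} (rankOf agentAt : Vector (Fin n) n) →
          {True (all? λ i → rankOf (agentAt i) ≟ i)} →
          {True (all? λ x → agentAt (rankOf x) ≟ x)} →
          Ranking n
ranking rankOf agentAt {l} {r} = permutation rankOf agentAt (toWitness l) (toWitness r)

all-vectors? : ∀ {n m} {P : Vector (Fin m) n → Set} →
               P Respects _≗_ → Decidable P → Dec (∀ f → P f)
all-vectors? {zero}  resp P? = map′ (λ p f → resp (λ ()) p) (λ p → p []) (P? [])
all-vectors? {suc n} resp P? =
  map′ (λ p f → resp (head-∷-tail f) (p (head f) (tail f)))
       (λ p x f → p (x ∷ f))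
       (all? λ x → all-vectors? (λ f≗g → resp (∷-cong x f≗g)) (λ f → P? (x ∷ f)))
  where
  head-∷-tail : ∀ f → (head f ∷ tail f) ≗ f
  head-∷-tail f zero    = refl
  head-∷-tail f (suc i) = refl
  ∷-cong : ∀ x {f g : Vector (Fin _) n} → f ≗ g → (x ∷ f) ≗ (x ∷ g)
  ∷-cong x f≗g zero    = refl
  ∷-cong x f≗g (suc i) = f≗g i

top-unique : ∀ {n} (r : Ranking (suc n)) {x y} → rank r x ≡ zero → ¬ Prefers r x y → y ≡ x
top-unique {n} r {x} {y} top not-better =
  Injection.injective (Inverse⇒Injection r) (trans (¬0<⇒≡0 (rank r y) not-better′) (sym top))
  where
  not-better′ : ¬ (zero {n} < rank r y)
  not-better′ = subst (λ i → ¬ (i < rank r y)) top not-better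
  ¬0<⇒≡0 : ∀ {n} (i : Fin (suc n)) → ¬ (zero {n} < i) → i ≡ zero
  ¬0<⇒≡0 zero    _     = refl
  ¬0<⇒≡0 (suc i) ¬0<1+i = ⊥-elim (¬0<1+i (s≤s z≤n))

husband⇒wife : ∀ {n} (μ : Matching n) {m w} → μ ⟨$⟩ʳ m ≡ w → μ ⟨$⟩ˡ w ≡ m
husband⇒wife μ eq = Inverse.inverseʳ μ (sym eq)

wife⇒husband : ∀ {n} (μ : Matching n) {m w} → μ ⟨$⟩ˡ w ≡ m → μ ⟨$⟩ʳ m ≡ w
wife⇒husband μ eq = Inverse.inverseˡ μ (sym eq)

marries-resp : ∀ {n} (m w : Fin n) → (λ (h : Vector (Fin n) n) → h m ≡ w) Respects _≗_
marries-resp m w f≗g eq = trans (sym (f≗g m)) eq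

module _ {d n} (πs σs : Fin d → Ranking n) (cm cw : Choice d n) where

  -- Stability of the matching m ↦ h m, phrased without its inverse (the wife of m′ is
  -- h m′) so that it can be decided for every h by enumeration.
  StableAssignment : Vector (Fin n) n → Set
  StableAssignment h =
    (∀ m m′ → h m ≡ h m′ → m ≡ m′) ×
    (∀ m m′ → ¬ (Prefers (πs (cm m)) (h m′) (h m) × Prefers (σs (cw (h m′))) m m′))

  stableAssignment? : Decidable StableAssignment
  stableAssignment? h =
    (all? λ m → all? λ m′ → (h m ≟ h m′) →-dec (m ≟ m′)) ×-dec
    (all? λ m → all? λ m′ → ¬? ((rank (πs (cm m)) (h m′) <? rank (πs (cm m)) (h m)) ×-dec
                                (rank (σs (cw (h m′))) m <? rank (σs (cw (h m′))) m′)))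

  stableAssignment-resp : StableAssignment Respects _≗_
  stableAssignment-resp f≗g (injective , unblocked) =
    (λ m m′ eq → injective m m′ (trans (f≗g m) (trans eq (sym (f≗g m′))))) ,
    (λ m m′ (p , q) → unblocked m m′
      ( subst₂ (Prefers (πs (cm m))) (sym (f≗g m′)) (sym (f≗g m)) p
      , subst (λ w → Prefers (σs (cw w)) m m′) (sym (f≗g m′)) q))

  stable⇒stableAssignment : ∀ μ → Stable πs σs cm cw μ → StableAssignment (μ ⟨$⟩ʳ_)
  stable⇒stableAssignment μ stable =
    (λ _ _ → Injection.injective (Inverse⇒Injection μ)) ,
    λ m m′ (p , q) → stable m (μ ⟨$⟩ʳ m′)
      (p , subst (Prefers (σs (cw (μ ⟨$⟩ʳ m′))) m) (sym (Perm.inverseˡ μ)) q)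

  stableAssignments⊆? : ∀ {G} → G Respects _≗_ → Decidable G →
                        Dec (∀ h → StableAssignment h → G h)
  stableAssignments⊆? G-resp G? =
    all-vectors? (λ f≗g sa⇒G sa → G-resp f≗g (sa⇒G (stableAssignment-resp (λ i → sym (f≗g i)) sa)))
                 (λ h → stableAssignment? h →-dec G? h)

  stableMatchings⊆ : ∀ {G} (G-resp : G Respects _≗_) (G? : Decidable G) →
                     {True (stableAssignments⊆? G-resp G?)} →
                     ∀ μ → Stable πs σs cm cw μ → G (μ ⟨$⟩ʳ_)
  stableMatchings⊆ G-resp G? {holds} μ stable =
    toWitness holds (μ ⟨$⟩ʳ_) (stable⇒stableAssignment μ stable)

module _ {d} (M : Mechanism d) (sp : StrategyProof M) {n}
         (πs σs : Fin d → Ranking (suc n)) (cm cw : Choice d (suc n)) where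

  man-keeps-top-choice : ∀ {m w} i → rank (πs (cm m)) w ≡ zero →
                         M _ πs σs (cm [ m ≔ i ]) cw ⟨$⟩ʳ m ≡ w → M _ πs σs cm cw ⟨$⟩ʳ m ≡ w
  man-keeps-top-choice {m} i top deviation =
    top-unique (πs (cm m)) top
      (subst (λ x → ¬ Prefers (πs (cm m)) x _) deviation (proj₁ (sp _ πs σs cm cw) m i))

  woman-keeps-top-choice : ∀ {w m} j → rank (σs (cw w)) m ≡ zero →
                           M _ πs σs cm (cw [ w ≔ j ]) ⟨$⟩ˡ w ≡ m → M _ πs σs cm cw ⟨$⟩ˡ w ≡ m
  woman-keeps-top-choice {w} j top deviation =
    top-unique (σs (cw w)) top
      (subst (λ x → ¬ Prefers (σs (cw w)) x _) deviation (proj₂ (sp _ πs σs cm cw) w j))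

module Counterexample (k : ℕ) where

  ℓ₀ ℓ₁ : Fin (suc (suc k))
  ℓ₀ = zero
  ℓ₁ = suc zero

  m₀ m₃ w₁ w₄ : Fin 5
  m₀ = # 0
  m₃ = # 3
  w₁ = # 1
  w₄ = # 4

  πs σs : Fin (suc (suc k)) → Ranking 5
  πs (suc zero) = ranking (# 3 ∷ # 0 ∷ # 4 ∷ # 1 ∷ # 2 ∷ []) (# 1 ∷ # 3 ∷ # 4 ∷ # 0 ∷ # 2 ∷ [])
  πs _          = Perm.id
  σs (suc zero) = ranking (# 2 ∷ # 4 ∷ # 0 ∷ # 1 ∷ # 3 ∷ []) (# 2 ∷ # 3 ∷ # 0 ∷ # 4 ∷ # 1 ∷ [])
  σs _          = Perm.id

  cm₀ cw₀ : Choice (suc (suc k)) 5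
  cm₀ = ℓ₁ ∷ ℓ₁ ∷ ℓ₀ ∷ ℓ₁ ∷ ℓ₁ ∷ []
  cw₀ = ℓ₀ ∷ ℓ₁ ∷ ℓ₀ ∷ ℓ₁ ∷ ℓ₀ ∷ []

  w₄-switches⇒m₀-marries-w₄ : ∀ μ → Stable πs σs cm₀ (cw₀ [ w₄ ≔ ℓ₁ ]) μ → μ ⟨$⟩ʳ m₀ ≡ w₄
  w₄-switches⇒m₀-marries-w₄ =
    stableMatchings⊆ πs σs cm₀ (cw₀ [ w₄ ≔ ℓ₁ ]) (marries-resp m₀ w₄) (λ h → h m₀ ≟ w₄)

  m₃-switches⇒m₃-marries-w₁ : ∀ μ → Stable πs σs (cm₀ [ m₃ ≔ ℓ₀ ]) cw₀ μ → μ ⟨$⟩ʳ m₃ ≡ w₁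
  m₃-switches⇒m₃-marries-w₁ =
    stableMatchings⊆ πs σs (cm₀ [ m₃ ≔ ℓ₀ ]) cw₀ (marries-resp m₃ w₁) (λ h → h m₃ ≟ w₁)

  truthful⇒¬both-marriages : ∀ μ → Stable πs σs cm₀ cw₀ μ → ¬ (μ ⟨$⟩ʳ m₀ ≡ w₄ × μ ⟨$⟩ʳ m₃ ≡ w₁)
  truthful⇒¬both-marriages = stableMatchings⊆ πs σs cm₀ cw₀
    (λ f≗g ¬both (p , q) → ¬both ( marries-resp m₀ w₄ (λ i → sym (f≗g i)) p
                                 , marries-resp m₃ w₁ (λ i → sym (f≗g i)) q))
    (λ h → ¬? ((h m₀ ≟ w₄) ×-dec (h m₃ ≟ w₁)))

theorem3 : (d : ℕ) → 2 ≤ d → ¬ Σ (Mechanism d) (λ M → FindsStable M × StrategyProof M)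
theorem3 (suc zero) (s≤s ())
theorem3 (suc (suc k)) _ (M , findsStable , sp) =
  truthful⇒¬both-marriages μ (findsStable _ πs σs cm₀ cw₀) (m₀-marries-w₄ , m₃-marries-w₁)
  where
  open Counterexample k
  μ μ₃ μ₄ : Matching 5
  μ  = M _ πs σs cm₀ cw₀
  μ₃ = M _ πs σs (cm₀ [ m₃ ≔ ℓ₀ ]) cw₀
  μ₄ = M _ πs σs cm₀ (cw₀ [ w₄ ≔ ℓ₁ ])

  m₀-marries-w₄ : μ ⟨$⟩ʳ m₀ ≡ w₄
  m₀-marries-w₄ = wife⇒husband μ (woman-keeps-top-choice M sp πs σs cm₀ cw₀ ℓ₁ refl
    (husband⇒wife μ₄ (w₄-switches⇒m₀-marries-w₄ μ₄ (findsStable _ πs σs cm₀ (cw₀ [ w₄ ≔ ℓ₁ ])))))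

  m₃-marries-w₁ : μ ⟨$⟩ʳ m₃ ≡ w₁
  m₃-marries-w₁ = man-keeps-top-choice M sp πs σs cm₀ cw₀ ℓ₀ refl
    (m₃-switches⇒m₃-marries-w₁ μ₃ (findsStable _ πs σs (cm₀ [ m₃ ≔ ℓ₀ ]) cw₀))
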